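{- Let $\omega$ be a finite permutation of length $l$ with natural word $\eta=\eta_1\cdots\eta_l$. For $1\le p\le l$, let $c_p$ be the tower index (first coordinate) of the cell created at the $p$-th step when sliding $\eta_1,\eta_2,\dots,\eta_l$ successively into $\varnothing$, and let $r_p$ be the tower index of the cell created at the $(l+1-p)$-th step when sliding the reversed word $\eta_l,\eta_{l-1},\dots,\eta_1$ successively into $\varnothing$. Then the Rothe diagram of $\omega$ is $$D_\omega=\{(r_p,c_p):1\le p\le l\}$$ (first coordinate = row, second = column).
   Context: $s_i=(i,i+1)$; permutations compose as functions ($\omega=s_{\alpha_1}\cdots s_{\alpha_\ell}$ means $\omega(x)=s_{\alpha_1}(\cdots s_{\alpha_\ell}(x))$); a reduced word of $\omega$ is such a word with $\ell=\ell(\omega)$ minimal. The Rothe diagram of $\omega\in S_n$ is $D_\omega=\{(i,j):1\le i,j\le n,\ j<\omega(i),\ i<\omega^{ -1}(j)\}$ (row $i$, column $j$). A cell is a pair $(i,j)$ of integers with $i\ge 1$, $j\ge 0$. A tower diagram is a finite set $\mathcal T$ of cells such that $(i,j)\in\mathcal T$ and $0\le k\le j$ imply $(i,k)\in\mathcal T$; its $i$-th tower consists of its cells with first coordinate $i$. The cell $(i,j)$ lies on the diagonal $x+y=i+j$. Flight paths (recursive): a cell $(i,j)\in\mathcal T$ has a flight path in $\mathcal T$ if either (F1) there is no cell $(i',j')\in\mathcal T$ with $i'<i$ and $i'+j'=i+j-1$ (flight path $\{(i,j)\}$), or (F2) such cells exist and, letting $(i',j')$ be the one with largest $i'$, $(i',j')$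 has a flight path and $(i',j'+1)\in\mathcal T$ (flight path $\{(i,j),(i',j'+1)\}\cup\mathrm{flightpath}((i',j'),\mathcal T)$). The flight number of such a cell is $a+b$ for $(a,b)$ the lexicographically smallest element of its flight path. Sliding: for a positive integer $\alpha$, $\alpha^{\searrow}\mathcal T$ is computed by the procedure $P(\gamma,m)$ started at $\gamma=\alpha$, $m=1$: (S1) if no cell $(i,j)\in\mathcal T$ with $i\ge m$ lies on $x+y=\gamma-1$: (a) if $(\gamma,0)\notin\mathcal T$ the result is $\mathcal T\cup\{(\gamma,0)\}$; (b) if $(\gamma,0)\in\mathcal T$, $(\gamma,1)\notin\mathcal T$ the slide terminates (without result); (c) if $(\gamma,0),(\gamma,1)\in\mathcal T$, continue with $P(\gamma+1,\gamma+1)$. (S2) Otherwise let $i\ge m$ be smallest with $(i,\gamma-1-i)\in\mathcal T$: (a) if $(i,\gamma-i)\notin\mathcal T$ the result is $\mathcal T\cup\{(i,\gamma-i)\}$; (b) if $(i,\gamma-i)\in\mathcal T$, $(i,\gamma-i+1)\notin\mathcal T$ the slide terminates; (c) if both are in $\mathcal T$, continue with $P(\gamma+1,i+1)$. A non-terminating slide adds exactly one new cell (the cell "created"). The tower diagram $\mathcal T_\omega$ of $\omega$ is obtained from $\varnothing$ by successively sliding the letters of any reduced word of $\omega$ (no slide terminates; the result is independent of the choice). The natural labelling of $\mathcal T_\omega$ labels its cells $1,2,\dots$ starting with the rightmost nonempty tower from bottom to top, then the next nonempty tower to its left from bottom to top, and so on. The natural word $\eta$ of $\omega$ is the reading word of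 this labelling: its $k$-th letter is the flight number of the cell labelled $k$ in the diagram formed by the cells labelled $1,\dots,k$. Equivalently, if the nonempty towers of $\mathcal T_\omega$ are at positions $i_1>\dots>i_s$ with heights $h_1,\dots,h_s$, then $\eta=(i_1,\dots,i_1+h_1-1)\cdots(i_s,\dots,i_s+h_s-1)$; it is a reduced word of $\omega$, and its reversal $\eta_l\cdots\eta_1$ is a reduced word of $\omega^{ -1}$. -}

module Defs where

open import Data.Nat using (ℕ; zero; suc; _+_; _≤_; _<_; _⊔_; _≡ᵇ_)
open import Data.Nat.Properties using (_≟_)
open import Data.Bool using (if_then_else_)
open import Data.List using (List; []; _∷_; length; map; filter; foldr; concatMap; upTo; downFrom)
open import Data.List.Relation.Unary.All using (All)
open import Data.List.Membership.Propositional using (_∈_; _∉_)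
open import Data.Product using (Σ; _×_; _,_; proj₁)
open import Data.Sum using (_⊎_)
open import Relation.Binary.PropositionalEquality using (_≡_)

-- Finite permutations (of the positive integers, support in [1..n]).
-- ω is stored with its inverse; it fixes 0 and every x > n.

record FinPerm : Set where
  field
    n     : ℕ
    fun   : ℕ → ℕ
    inv   : ℕ → ℕ
    inv-fun : ∀ x → inv (fun x) ≡ x
    fun-inv : ∀ x → fun (inv x) ≡ x
    fixed : ∀ x → (x ≡ 0 ⊎ n < x) → fun x ≡ x
open FinPerm public

s : ℕ → ℕ → ℕ
s a x = if x ≡ᵇ a then suc a else (if x ≡ᵇ suc a then a else x)

evalWord : List ℕ → ℕ → ℕ
evalWord [] x = x
evalWord (a ∷ w) x = s a (evalWord w x)

Represents : List ℕ → FinPerm → Set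
Represents w ω = All (1 ≤_) w × (∀ x → evalWord w x ≡ fun ω x)

IsReducedWord : FinPerm → List ℕ → Set
IsReducedWord ω w = Represents w ω × (∀ v → Represents v ω → length w ≤ length v)

InRothe : FinPerm → ℕ × ℕ → Set
InRothe ω (i , j) =
  1 ≤ i × i ≤ n ω × 1 ≤ j × j ≤ n ω × j < fun ω i × i < inv ω j

Cell : Set
Cell = ℕ × ℕ

Diagram : Set
Diagram = List Cell

NoDiag : Diagram → ℕ → ℕ → Set
NoDiag T m γ = ∀ i j → m ≤ i → suc (i + j) ≡ γ → (i , j) ∉ T

FirstOnDiag : Diagram → ℕ → ℕ → ℕ → ℕ → Set
FirstOnDiag T m γ i j =
  m ≤ i × suc (i + j) ≡ γ × (i , j) ∈ T ×
  (∀ i' j' → m ≤ i' → i' < i → suc (i' + j') ≡ γ → (i' , j') ∉ T)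

-- The procedure P(γ , m) on T, ending with the creation of cell c.
-- (Terminating cases (S1b), (S2b) have no constructor: no result.)
data SlideP (T : Diagram) : ℕ → ℕ → Cell → Set where
  s1a : ∀ {γ m} → NoDiag T m γ → (γ , 0) ∉ T → SlideP T γ m (γ , 0)
  s1c : ∀ {γ m c} → NoDiag T m γ → (γ , 0) ∈ T → (γ , 1) ∈ T →
        SlideP T (suc γ) (suc γ) c → SlideP T γ m c
  s2a : ∀ {γ m i j} → FirstOnDiag T m γ i j → (i , suc j) ∉ T →
        SlideP T γ m (i , suc j)
  s2c : ∀ {γ m i j c} → FirstOnDiag T m γ i j → (i , suc j) ∈ T →
        (i , suc (suc j)) ∈ T → SlideP T (suc γ) (suc i) c → SlideP T γ m c

data SlideSeq : Diagram → List ℕ → Diagram → List Cell → Set where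
  done : ∀ {T} → SlideSeq T [] T []
  step : ∀ {T a w T' c cs} → 1 ≤ a → SlideP T a 1 c →
         SlideSeq (c ∷ T) w T' cs → SlideSeq T (a ∷ w) T' (c ∷ cs)

Creates : List ℕ → List Cell → Set
Creates w cs = Σ Diagram λ T → SlideSeq [] w T cs

height : Diagram → ℕ → ℕ
height T i = length (filter (λ c → proj₁ c ≟ i) T)

maxTower : Diagram → ℕ
maxTower T = foldr (λ c m → proj₁ c ⊔ m) 0 T

towerWord : ℕ → ℕ → List ℕ
towerWord i h = map (i +_) (upTo h)

natWord : Diagram → List ℕ
natWord T = concatMap (λ i → towerWord i (height T i)) (map suc (downFrom (maxTower T)))

IsNaturalWord : FinPerm → List ℕ → Set
IsNaturalWord ω η =
  Σ (List ℕ) λ w → IsReducedWord ω w ×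
  Σ Diagram λ T → Σ (List Cell) λ cs → SlideSeq [] w T cs × η ≡ natWord T

-- Write π_h for the permutation evaluated by the word (i₁,…,i₁+h₁−1)⋯(i_s,…,i_s+h_s−1) of a
-- tower diagram with heights h.  A single tower with base i and height h evaluates to the cycle
-- i ↦ i+1 ↦ ⋯ ↦ i+h ↦ i, so π_h is an explicit product of cycles.  The key fact about sliding is
-- that sliding α into T creates a cell in tower π_T(α) and turns π_T into π_T ∘ s_α, and that the
-- slide succeeds whenever α is an ascent of π_T.  Every letter of the natural word η of ω and of
-- its reversal is such an ascent.  Sliding η creates its cells in the towers read off the
-- natural labelling (the columns); sliding the reversal creates, read backwards, the cell of the
-- letter i+k of tower i in tower σ⁻¹(i+k), with σ the product of the cycles of the towers left
-- of i (the rows).  A computation with the cycles shows that these (row, column) pairs are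
-- exactly the inversions (i,j), j < ω(i), i < ω⁻¹(j).
module Submission where

open import Defs
open import Data.Nat using (ℕ; zero; suc; _+_; _∸_; _≤_; _<_; _≡ᵇ_; z≤n; s≤s; z<s; _<?_; _≤?_)
open import Data.Nat.Properties
open import Data.Bool using (true; false)
open import Data.List using (List; []; _∷_; _++_; [_]; length; map; reverse; zip; replicate; upTo; applyUpTo; concatMap; downFrom)
open import Data.List.Properties
  using (map-upTo; map-∘; map-cong; reverse-++; unfold-reverse; reverse-involutive; reverse-map;
         filter-accept; filter-reject; length-replicate)
open import Data.List.Membership.Propositional using (_∈_; _∉_)
open import Data.List.Membership.Propositional.Properties using (∈-++⁺ˡ; ∈-++⁺ʳ; ∈-++⁻)
open import Data.List.Relation.Unary.Any using (here; there)
open import Data.Product using (Σ; _×_; _,_; proj₁; proj₂)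
open import Data.Sum using (_⊎_; inj₁; inj₂)
open import Data.Empty using (⊥; ⊥-elim)
open import Data.Unit using (⊤; tt)
open import Relation.Nullary using (¬_; yes; no)
open import Relation.Binary using (tri<; tri≈; tri>)
open import Relation.Binary.PropositionalEquality hiding ([_])
open import Function.Bundles using (_⇔_; mk⇔; Equivalence)
import Function.Properties.Equivalence as ⇔
open ≡-Reasoning

≡ᵇ-refl : ∀ a → (a ≡ᵇ a) ≡ true
≡ᵇ-refl zero = refl
≡ᵇ-refl (suc a) = ≡ᵇ-refl a

≢⇒≡ᵇ-false : ∀ a b → a ≢ b → (a ≡ᵇ b) ≡ false
≢⇒≡ᵇ-false zero zero a≢b = ⊥-elim (a≢b refl)
≢⇒≡ᵇ-false zero (suc b) _ = refl
≢⇒≡ᵇ-false (suc a) zero _ = refl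
≢⇒≡ᵇ-false (suc a) (suc b) a≢b = ≢⇒≡ᵇ-false a b (λ e → a≢b (cong suc e))

s-at : ∀ a → s a a ≡ suc a
s-at a rewrite ≡ᵇ-refl a = refl

s-at-suc : ∀ a → s a (suc a) ≡ a
s-at-suc a rewrite ≢⇒≡ᵇ-false (suc a) a 1+n≢n | ≡ᵇ-refl a = refl

s-fix : ∀ a x → x ≢ a → x ≢ suc a → s a x ≡ x
s-fix a x x≢a x≢1+a rewrite ≢⇒≡ᵇ-false x a x≢a | ≢⇒≡ᵇ-false x (suc a) x≢1+a = refl

data SView (a x : ℕ) : Set where
  at        : x ≡ a → SView a x
  at-suc    : x ≡ suc a → SView a x
  elsewhere : x ≢ a → x ≢ suc a → SView a x

s-view : ∀ a x → SView a x
s-view a x with x ≟ a | x ≟ suc a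
... | yes x≡a | _        = at x≡a
... | no _    | yes x≡1+a = at-suc x≡1+a
... | no x≢a  | no x≢1+a  = elsewhere x≢a x≢1+a

s-involutive : ∀ a x → s a (s a x) ≡ x
s-involutive a x with s-view a x
... | at refl rewrite s-at a = s-at-suc a
... | at-suc refl rewrite s-at-suc a = s-at a
... | elsewhere x≢a x≢1+a rewrite s-fix a x x≢a x≢1+a = s-fix a x x≢a x≢1+a

evalWord-++ : ∀ u v x → evalWord (u ++ v) x ≡ evalWord u (evalWord v x)
evalWord-++ [] v x = refl
evalWord-++ (a ∷ u) v x = cong (s a) (evalWord-++ u v x)

evalWord-reverse-inverseˡ : ∀ v x → evalWord (reverse v) (evalWord v x) ≡ x
evalWord-reverse-inverseˡ [] x = refl
evalWord-reverse-inverseˡ (a ∷ v) x = begin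
  evalWord (reverse (a ∷ v)) (s a (evalWord v x))     ≡⟨ cong (λ w → evalWord w (s a (evalWord v x))) (unfold-reverse a v) ⟩
  evalWord (reverse v ++ [ a ]) (s a (evalWord v x))  ≡⟨ evalWord-++ (reverse v) [ a ] _ ⟩
  evalWord (reverse v) (s a (s a (evalWord v x)))     ≡⟨ cong (evalWord (reverse v)) (s-involutive a _) ⟩
  evalWord (reverse v) (evalWord v x)                 ≡⟨ evalWord-reverse-inverseˡ v x ⟩
  x                                                   ∎

evalWord-reverse-inverseʳ : ∀ v x → evalWord v (evalWord (reverse v) x) ≡ x
evalWord-reverse-inverseʳ v x =
  subst (λ w → evalWord w (evalWord (reverse v) x) ≡ x) (reverse-involutive v)
        (evalWord-reverse-inverseˡ (reverse v) x)

-- The cycle of a single tower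

towerWord-suc : ∀ i h → towerWord i (suc h) ≡ i ∷ towerWord (suc i) h
towerWord-suc i h = cong₂ _∷_ (+-identityʳ i) (begin
  map (i +_) (applyUpTo suc h)     ≡⟨ cong (map (i +_)) (sym (map-upTo suc h)) ⟩
  map (i +_) (map suc (upTo h))    ≡⟨ sym (map-∘ (upTo h)) ⟩
  map (λ k → i + suc k) (upTo h)   ≡⟨ map-cong (+-suc i) (upTo h) ⟩
  towerWord (suc i) h              ∎)

towerPerm : ℕ → ℕ → ℕ → ℕ
towerPerm i h = evalWord (towerWord i h)

towerPerm⁻¹ : ℕ → ℕ → ℕ → ℕ
towerPerm⁻¹ i h = evalWord (reverse (towerWord i h))

towerPerm-suc : ∀ i h x → towerPerm i (suc h) x ≡ s i (towerPerm (suc i) h x)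
towerPerm-suc i h x = cong (λ w → evalWord w x) (towerWord-suc i h)

towerPerm⁻¹-suc : ∀ i h x → towerPerm⁻¹ i (suc h) x ≡ towerPerm⁻¹ (suc i) h (s i x)
towerPerm⁻¹-suc i h x = begin
  evalWord (reverse (towerWord i (suc h))) x          ≡⟨ cong (λ w → evalWord (reverse w) x) (towerWord-suc i h) ⟩
  evalWord (reverse (i ∷ towerWord (suc i) h)) x      ≡⟨ cong (λ w → evalWord w x) (unfold-reverse i (towerWord (suc i) h)) ⟩
  evalWord (reverse (towerWord (suc i) h) ++ [ i ]) x ≡⟨ evalWord-++ (reverse (towerWord (suc i) h)) [ i ] x ⟩
  towerPerm⁻¹ (suc i) h (s i x)                       ∎

<⇒≢1+ : ∀ {x i} → x < i → x ≢ suc i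
<⇒≢1+ x<i refl = <-asym x<i (n<1+n _)

towerPerm-below : ∀ i h x → x < i → towerPerm i h x ≡ x
towerPerm-below i zero x x<i = refl
towerPerm-below i (suc h) x x<i
  rewrite towerPerm-suc i h x | towerPerm-below (suc i) h x (m<n⇒m<1+n x<i) = s-fix i x (<⇒≢ x<i) (<⇒≢1+ x<i)

towerPerm-above : ∀ i h x → i + h < x → towerPerm i h x ≡ x
towerPerm-above i zero x top<x = refl
towerPerm-above i (suc h) x top<x
  rewrite towerPerm-suc i h x | towerPerm-above (suc i) h x (subst (_< x) (+-suc i h) top<x) =
  s-fix i x (>⇒≢ (≤-<-trans (m≤m+n i (suc h)) top<x))
            (>⇒≢ (≤-<-trans (s≤s (m≤m+n i h)) (subst (_< x) (+-suc i h) top<x)))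

towerPerm-top : ∀ i h → towerPerm i h (i + h) ≡ i
towerPerm-top i zero rewrite +-identityʳ i = refl
towerPerm-top i (suc h) rewrite towerPerm-suc i h (i + suc h) | +-suc i h | towerPerm-top (suc i) h = s-at-suc i

towerPerm-inside : ∀ i h x → i ≤ x → x < i + h → towerPerm i h x ≡ suc x
towerPerm-inside i zero x i≤x x<i+0 = ⊥-elim (<-irrefl refl (<-≤-trans x<i+0 (subst (_≤ x) (sym (+-identityʳ i)) i≤x)))
towerPerm-inside i (suc h) x i≤x x<top with m≤n⇒m<n∨m≡n i≤x
... | inj₂ refl rewrite towerPerm-suc i h i | towerPerm-below (suc i) h i (n<1+n i) = s-at i
... | inj₁ i<x rewrite towerPerm-suc i h x | towerPerm-inside (suc i) h x i<x (subst (x <_) (+-suc i h) x<top) =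
  s-fix i (suc x) (>⇒≢ (m<n⇒m<1+n i<x)) (λ e → <⇒≢ i<x (sym (suc-injective e)))

data TowerPermView (i h x : ℕ) : Set where
  below  : x < i → towerPerm i h x ≡ x → TowerPermView i h x
  inside : i ≤ x → x < i + h → towerPerm i h x ≡ suc x → TowerPermView i h x
  top    : x ≡ i + h → towerPerm i h x ≡ i → TowerPermView i h x
  above  : i + h < x → towerPerm i h x ≡ x → TowerPermView i h x

towerPerm-view : ∀ i h x → TowerPermView i h x
towerPerm-view i h x with x <? i
... | yes x<i = below x<i (towerPerm-below i h x x<i)
... | no x≮i with <-cmp x (i + h)
...   | tri< x<top _ _  = inside (≮⇒≥ x≮i) x<top (towerPerm-inside i h x (≮⇒≥ x≮i) x<top)
...   | tri≈ _ x≡top _  = top x≡top (trans (cong (towerPerm i h) x≡top) (towerPerm-top i h))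
...   | tri> _ _ top<x  = above top<x (towerPerm-above i h x top<x)

towerPerm-preserves-> : ∀ i h x y → y < i → y < x → y < towerPerm i h x
towerPerm-preserves-> i h x y y<i y<x with towerPerm-view i h x
... | below _ e    rewrite e = y<x
... | inside _ _ e rewrite e = m<n⇒m<1+n y<x
... | top _ e      rewrite e = y<i
... | above _ e    rewrite e = y<x

towerPerm⁻¹-below : ∀ i h x → x < i → towerPerm⁻¹ i h x ≡ x
towerPerm⁻¹-below i zero x x<i = refl
towerPerm⁻¹-below i (suc h) x x<i rewrite towerPerm⁻¹-suc i h x | s-fix i x (<⇒≢ x<i) (<⇒≢1+ x<i) =
  towerPerm⁻¹-below (suc i) h x (m<n⇒m<1+n x<i)

towerPerm⁻¹-bottom : ∀ i h → towerPerm⁻¹ i h i ≡ i + h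
towerPerm⁻¹-bottom i zero = sym (+-identityʳ i)
towerPerm⁻¹-bottom i (suc h) rewrite towerPerm⁻¹-suc i h i | s-at i | towerPerm⁻¹-bottom (suc i) h = sym (+-suc i h)

towerPerm⁻¹-≥ : ∀ i h x → i < x → i ≤ towerPerm⁻¹ i h x
towerPerm⁻¹-≥ i zero x i<x = <⇒≤ i<x
towerPerm⁻¹-≥ i (suc h) x i<x rewrite towerPerm⁻¹-suc i h x with m≤n⇒m<n∨m≡n i<x
... | inj₂ refl rewrite s-at-suc i | towerPerm⁻¹-below (suc i) h i (n<1+n i) = ≤-refl
... | inj₁ 1+i<x rewrite s-fix i x (>⇒≢ i<x) (>⇒≢ 1+i<x) = ≤-trans (n≤1+n i) (towerPerm⁻¹-≥ (suc i) h x 1+i<x)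

towerPerm⁻¹-mono : ∀ i h x y → i < x → x < y → towerPerm⁻¹ i h x < towerPerm⁻¹ i h y
towerPerm⁻¹-mono i zero x y i<x x<y = x<y
towerPerm⁻¹-mono i (suc h) x y i<x x<y
  rewrite towerPerm⁻¹-suc i h x | towerPerm⁻¹-suc i h y | s-fix i y (>⇒≢ (<-trans i<x x<y)) (>⇒≢ (≤-<-trans i<x x<y))
  with m≤n⇒m<n∨m≡n i<x
... | inj₂ refl rewrite s-at-suc i | towerPerm⁻¹-below (suc i) h i (n<1+n i) = towerPerm⁻¹-≥ (suc i) h y x<y
... | inj₁ 1+i<x rewrite s-fix i x (>⇒≢ i<x) (>⇒≢ 1+i<x) = towerPerm⁻¹-mono (suc i) h x y 1+i<x x<y

towerPerm-comm-s : ∀ i h γ y → i + h < γ → towerPerm i h (s γ y) ≡ s γ (towerPerm i h y)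
towerPerm-comm-s i h γ y top<γ with s-view γ y
... | at refl rewrite s-at γ | towerPerm-above i h γ top<γ | towerPerm-above i h (suc γ) (m<n⇒m<1+n top<γ) =
  sym (s-at γ)
... | at-suc refl rewrite s-at-suc γ | towerPerm-above i h γ top<γ | towerPerm-above i h (suc γ) (m<n⇒m<1+n top<γ) =
  sym (s-at-suc γ)
... | elsewhere y≢γ y≢1+γ rewrite s-fix γ y y≢γ y≢1+γ with towerPerm-view i h y
...   | below _ e    rewrite e = sym (s-fix γ y y≢γ y≢1+γ)
...   | inside _ y<top e rewrite e =
  sym (s-fix γ (suc y) (<⇒≢ (<-≤-trans (s≤s y<top) top<γ)) (λ q → <⇒≢ (<-trans y<top top<γ) (suc-injective q)))
...   | top _ e      rewrite e =
  sym (s-fix γ i (<⇒≢ (≤-<-trans (m≤m+n i h) top<γ)) (<⇒≢ (≤-<-trans (m≤m+n i h) (m<n⇒m<1+n top<γ))))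
...   | above _ e    rewrite e = sym (s-fix γ y y≢γ y≢1+γ)

towerPerm-grow : ∀ i h y → towerPerm i (suc h) y ≡ towerPerm i h (s (i + h) y)
towerPerm-grow i h y with s-view (i + h) y
... | at refl rewrite s-at (i + h)
      | towerPerm-inside i (suc h) (i + h) (m≤m+n i h) (subst (i + h <_) (sym (+-suc i h)) (n<1+n _)) =
  sym (towerPerm-above i h (suc (i + h)) (n<1+n _))
... | at-suc refl rewrite s-at-suc (i + h) | towerPerm-top i h =
  trans (cong (towerPerm i (suc h)) (sym (+-suc i h))) (towerPerm-top i (suc h))
... | elsewhere y≢top y≢1+top rewrite s-fix (i + h) y y≢top y≢1+top with towerPerm-view i h y
...   | below y<i e  rewrite e = towerPerm-below i (suc h) y y<i
...   | inside i≤y y<top e rewrite e = towerPerm-inside i (suc h) y i≤y (subst (y <_) (sym (+-suc i h)) (m<n⇒m<1+n y<top))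
...   | top y≡top _  = ⊥-elim (y≢top y≡top)
...   | above top<y e rewrite e =
  towerPerm-above i (suc h) y (subst (_< y) (sym (+-suc i h)) (≤∧≢⇒< top<y (≢-sym y≢1+top)))

towerPerm-shift-s : ∀ i h γ y → i ≤ γ → suc (suc γ) ≤ i + h → towerPerm i h (s γ y) ≡ s (suc γ) (towerPerm i h y)
towerPerm-shift-s i h γ y i≤γ 2+γ≤top with s-view γ y
... | at refl rewrite s-at γ | towerPerm-inside i h (suc γ) (m≤n⇒m≤1+n i≤γ) 2+γ≤top
                   | towerPerm-inside i h γ i≤γ (<-trans (n<1+n γ) 2+γ≤top) = sym (s-at (suc γ))
... | at-suc refl rewrite s-at-suc γ | towerPerm-inside i h (suc γ) (m≤n⇒m≤1+n i≤γ) 2+γ≤top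
                       | towerPerm-inside i h γ i≤γ (<-trans (n<1+n γ) 2+γ≤top) = sym (s-at-suc (suc γ))
... | elsewhere y≢γ y≢1+γ rewrite s-fix γ y y≢γ y≢1+γ with towerPerm-view i h y
...   | below y<i e rewrite e =
  sym (s-fix (suc γ) y (<⇒≢ (<-≤-trans y<i (m≤n⇒m≤1+n i≤γ))) (<⇒≢ (<-≤-trans y<i (m≤n⇒m≤1+n (m≤n⇒m≤1+n i≤γ)))))
...   | inside _ _ e rewrite e =
  sym (s-fix (suc γ) (suc y) (λ q → y≢γ (suc-injective q)) (λ q → y≢1+γ (suc-injective q)))
...   | top _ e rewrite e = sym (s-fix (suc γ) i (<⇒≢ (s≤s i≤γ)) (<⇒≢ (s≤s (m≤n⇒m≤1+n i≤γ))))
...   | above top<y e rewrite e =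
  sym (s-fix (suc γ) y (>⇒≢ (<-trans (n<1+n _) (≤-<-trans 2+γ≤top top<y))) (>⇒≢ (≤-<-trans 2+γ≤top top<y)))

-- Products of consecutive tower cycles

sweep : (ℕ → ℕ) → ℕ → ℕ → ℕ → ℕ
sweep h m zero x = x
sweep h m (suc K) x = sweep h (suc m) K (towerPerm m (h m) x)

sweep-+ : ∀ h m a b x → sweep h m (a + b) x ≡ sweep h (m + a) b (sweep h m a x)
sweep-+ h m zero b x rewrite +-identityʳ m = refl
sweep-+ h m (suc a) b x rewrite +-suc m a = sweep-+ h (suc m) a b (towerPerm m (h m) x)

sweep-at : ∀ h m a b x →
  sweep h m (a + suc b) x ≡ sweep h (suc (m + a)) b (towerPerm (m + a) (h (m + a)) (sweep h m a x))
sweep-at h m a b x = sweep-+ h m a (suc b) x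

sweep-suc : ∀ h m K x → sweep h m (suc K) x ≡ towerPerm (m + K) (h (m + K)) (sweep h m K x)
sweep-suc h m K x = trans (cong (λ k → sweep h m k x) (sym (+-comm K 1))) (sweep-+ h m K 1 x)

sweep-below : ∀ h m K y → y < m → sweep h m K y ≡ y
sweep-below h m zero y y<m = refl
sweep-below h m (suc K) y y<m rewrite towerPerm-below m (h m) y y<m = sweep-below h (suc m) K y (m<n⇒m<1+n y<m)

sweep-preserves-> : ∀ h m K x y → y < m → y < x → y < sweep h m K x
sweep-preserves-> h m zero x y y<m y<x = y<x
sweep-preserves-> h m (suc K) x y y<m y<x =
  sweep-preserves-> h (suc m) K _ y (m<n⇒m<1+n y<m) (towerPerm-preserves-> m (h m) x y y<m y<x)

sweep-cong : ∀ h h′ m K x → (∀ i → m ≤ i → i < m + K → h i ≡ h′ i) → sweep h m K x ≡ sweep h′ m K x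
sweep-cong h h′ m zero x h≡h′ = refl
sweep-cong h h′ m (suc K) x h≡h′ rewrite h≡h′ m ≤-refl (m<m+n m z<s) =
  sweep-cong h h′ (suc m) K _ (λ i m<i i<end → h≡h′ i (<⇒≤ m<i) (subst (i <_) (sym (+-suc m K)) i<end))

sweep-idle : ∀ h m K x → (∀ i → m ≤ i → h i ≡ 0) → sweep h m K x ≡ x
sweep-idle h m zero x empty = refl
sweep-idle h m (suc K) x empty rewrite empty m ≤-refl = sweep-idle h (suc m) K x (λ i m<i → empty i (<⇒≤ m<i))

EndBelow : (ℕ → ℕ) → ℕ → ℕ → ℕ → Set
EndBelow h m i γ = ∀ i′ → m ≤ i′ → i′ < i → i′ + h i′ < γ

endBelow-suc : ∀ {h m a γ} → EndBelow h m (m + suc a) γ → EndBelow h (suc m) (suc m + a) γ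
endBelow-suc {m = m} {a} ends i′ m<i′ i′<end = ends i′ (<⇒≤ m<i′) (subst (i′ <_) (sym (+-suc m a)) i′<end)

sweep-fix-≥ : ∀ h m a γ z → EndBelow h m (m + a) γ → γ ≤ z → sweep h m a z ≡ z
sweep-fix-≥ h m zero γ z ends γ≤z = refl
sweep-fix-≥ h m (suc a) γ z ends γ≤z
  rewrite towerPerm-above m (h m) z (<-≤-trans (ends m ≤-refl (m<m+n m z<s)) γ≤z) =
  sweep-fix-≥ h (suc m) a γ z (endBelow-suc ends) γ≤z

sweep-comm-s : ∀ h m a γ y → EndBelow h m (m + a) γ → sweep h m a (s γ y) ≡ s γ (sweep h m a y)
sweep-comm-s h m zero γ y ends = refl
sweep-comm-s h m (suc a) γ y ends rewrite towerPerm-comm-s m (h m) γ y (ends m ≤-refl (m<m+n m z<s)) =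
  sweep-comm-s h (suc m) a γ _ (endBelow-suc ends)

sweep-through : ∀ h m a b γ z → EndBelow h m (m + a) γ → γ ≤ z →
  sweep h m (a + suc b) z ≡ sweep h (suc (m + a)) b (towerPerm (m + a) (h (m + a)) z)
sweep-through h m a b γ z ends γ≤z =
  trans (sweep-at h m a b z)
        (cong (λ w → sweep h (suc (m + a)) b (towerPerm (m + a) (h (m + a)) w)) (sweep-fix-≥ h m a γ z ends γ≤z))

split-interval : ∀ m i K → m ≤ i → i < m + K → Σ ℕ λ a → Σ ℕ λ b → m + a ≡ i × K ≡ a + suc b
split-interval m i K m≤i i<m+K = i ∸ m , K ∸ suc (i ∸ m) , m+[n∸m]≡n m≤i , sym (trans (+-suc _ _) (m+[n∸m]≡n a<K))
  where
  a<K : i ∸ m < K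
  a<K = +-cancelˡ-< m (i ∸ m) K (subst (_< m + K) (sym (m+[n∸m]≡n m≤i)) i<m+K)

towersWord : (ℕ → ℕ) → ℕ → List ℕ
towersWord h N = concatMap (λ i → towerWord i (h i)) (map suc (downFrom N))

towersPerm : (ℕ → ℕ) → ℕ → ℕ → ℕ
towersPerm h N = evalWord (towersWord h N)

towersPerm⁻¹ : (ℕ → ℕ) → ℕ → ℕ → ℕ
towersPerm⁻¹ h N = evalWord (reverse (towersWord h N))

towersPerm-suc : ∀ h N x → towersPerm h (suc N) x ≡ towerPerm (suc N) (h (suc N)) (towersPerm h N x)
towersPerm-suc h N x = evalWord-++ (towerWord (suc N) (h (suc N))) (towersWord h N) x

towersPerm⁻¹-suc : ∀ h N x → towersPerm⁻¹ h (suc N) x ≡ towersPerm⁻¹ h N (towerPerm⁻¹ (suc N) (h (suc N)) x)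
towersPerm⁻¹-suc h N x =
  trans (cong (λ w → evalWord w x) (reverse-++ (towerWord (suc N) (h (suc N))) (towersWord h N)))
        (evalWord-++ (reverse (towersWord h N)) (reverse (towerWord (suc N) (h (suc N)))) x)

towersPerm-sweep : ∀ h N x → towersPerm h N x ≡ sweep h 1 N x
towersPerm-sweep h zero x = refl
towersPerm-sweep h (suc N) x = begin
  towersPerm h (suc N) x                               ≡⟨ towersPerm-suc h N x ⟩
  towerPerm (suc N) (h (suc N)) (towersPerm h N x)     ≡⟨ cong (towerPerm (suc N) (h (suc N))) (towersPerm-sweep h N x) ⟩
  towerPerm (suc N) (h (suc N)) (sweep h 1 N x)        ≡⟨ sym (sweep-suc h 1 N x) ⟩
  sweep h 1 (suc N) x                                  ∎

height-∷-≡ : ∀ (c : Cell) T i → proj₁ c ≡ i → height (c ∷ T) i ≡ suc (height T i)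
height-∷-≡ c T i e = cong length (filter-accept (λ c′ → proj₁ c′ ≟ i) {c} {T} e)

height-∷-≢ : ∀ (c : Cell) T i → proj₁ c ≢ i → height (c ∷ T) i ≡ height T i
height-∷-≢ c T i e = cong length (filter-reject (λ c′ → proj₁ c′ ≟ i) {c} {T} e)

height-∷-≤ : ∀ (c : Cell) T i → height T i ≤ height (c ∷ T) i
height-∷-≤ c T i with proj₁ c ≟ i
... | yes e = ≤-trans (n≤1+n _) (≤-reflexive (sym (height-∷-≡ c T i e)))
... | no e  = ≤-reflexive (sym (height-∷-≢ c T i e))

height-beyond-max : ∀ T i → maxTower T < i → height T i ≡ 0
height-beyond-max [] i _ = refl
height-beyond-max (c ∷ T) i max<i =
  trans (height-∷-≢ c T i (<⇒≢ (≤-<-trans (m≤m⊔n (proj₁ c) (maxTower T)) max<i)))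
        (height-beyond-max T i (≤-<-trans (m≤n⊔m (proj₁ c) (maxTower T)) max<i))

height≤length : ∀ T i → height T i ≤ length T
height≤length [] i = z≤n
height≤length (c ∷ T) i with proj₁ c ≟ i
... | yes e = ≤-trans (≤-reflexive (height-∷-≡ c T i e)) (s≤s (height≤length T i))
... | no e  = ≤-trans (≤-reflexive (height-∷-≢ c T i e)) (m≤n⇒m≤1+n (height≤length T i))

natPerm : Diagram → ℕ → ℕ
natPerm T = evalWord (natWord T)

natPerm-sweep : ∀ T K x → maxTower T ≤ K → natPerm T x ≡ sweep (height T) 1 K x
natPerm-sweep T K x max≤K = begin
  natPerm T x                                          ≡⟨ towersPerm-sweep h N x ⟩
  sweep h 1 N x                                        ≡⟨ sym (sweep-idle h (suc N) (K ∸ N) _ (height-beyond-max T)) ⟩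
  sweep h (1 + N) (K ∸ N) (sweep h 1 N x)              ≡⟨ sym (sweep-+ h 1 N (K ∸ N) x) ⟩
  sweep h 1 (N + (K ∸ N)) x                            ≡⟨ cong (λ k → sweep h 1 k x) (m+[n∸m]≡n max≤K) ⟩
  sweep h 1 K x                                        ∎
  where
  h = height T
  N = maxTower T

IsTowerDiagram : Diagram → Set
IsTowerDiagram T = ∀ i j → ((i , j) ∈ T → j < height T i) × (j < height T i → (i , j) ∈ T)

isTowerDiagram-[] : IsTowerDiagram []
isTowerDiagram-[] i j = (λ ()) , (λ ())

isTowerDiagram-∷ : ∀ T (c : Cell) → IsTowerDiagram T → proj₂ c ≡ height T (proj₁ c) → IsTowerDiagram (c ∷ T)
isTowerDiagram-∷ T (p , q) V q≡height i j = to , from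
  where
  to : (i , j) ∈ (p , q) ∷ T → j < height ((p , q) ∷ T) i
  to (here refl) rewrite height-∷-≡ (p , q) T p refl | q≡height = n<1+n _
  to (there mem) = <-≤-trans (proj₁ (V i j) mem) (height-∷-≤ (p , q) T i)
  from : j < height ((p , q) ∷ T) i → (i , j) ∈ (p , q) ∷ T
  from j<height with p ≟ i
  ... | no p≢i = there (proj₂ (V i j) (subst (j <_) (height-∷-≢ (p , q) T i p≢i) j<height))
  ... | yes refl with m≤n⇒m<n∨m≡n (≤-pred (subst (j <_) (height-∷-≡ (p , q) T p refl) j<height))
  ...   | inj₁ j<old = there (proj₂ (V p j) j<old)
  ...   | inj₂ refl rewrite q≡height = here refl

∉⇒height≤ : ∀ {T} → IsTowerDiagram T → ∀ i j → (i , j) ∉ T → height T i ≤ j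
∉⇒height≤ V i j ij∉T = ≮⇒≥ (λ j<height → ij∉T (proj₂ (V i j) j<height))

∈⇒<top : ∀ {T} → IsTowerDiagram T → ∀ {i j} → (i , j) ∈ T → i + j < i + height T i
∈⇒<top V {i} {j} mem = +-monoʳ-< i (proj₁ (V i j) mem)

onDiagonal⇒≤ : ∀ {i j γ} → suc (i + j) ≡ γ → i ≤ γ
onDiagonal⇒≤ {i} {j} refl = m≤n⇒m≤1+n (m≤m+n i j)

emptyDiagonal⇒endBelow : ∀ {T} → IsTowerDiagram T → ∀ m i γ →
  (∀ i′ j′ → m ≤ i′ → i′ < i → suc (i′ + j′) ≡ γ → (i′ , j′) ∉ T) → i ≤ γ → EndBelow (height T) m i γ
emptyDiagonal⇒endBelow {T} V m i γ empty i≤γ i′ m≤i′ i′<i =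
  ≤-<-trans (+-monoʳ-≤ i′ height≤j′) (subst (i′ + j′ <_) on-γ (n<1+n _))
  where
  j′ = γ ∸ suc i′
  on-γ : suc (i′ + j′) ≡ γ
  on-γ = m+[n∸m]≡n (<-≤-trans i′<i i≤γ)
  height≤j′ : height T i′ ≤ j′
  height≤j′ = ∉⇒height≤ V i′ j′ (empty i′ j′ m≤i′ i′<i on-γ)

noDiag⇒empty : ∀ {T m γ} → NoDiag T m γ → ∀ i′ j′ → m ≤ i′ → i′ < γ → suc (i′ + j′) ≡ γ → (i′ , j′) ∉ T
noDiag⇒empty noDiag i′ j′ m≤i′ _ = noDiag i′ j′ m≤i′

-- The effect of a slide

SweepEffect : Diagram → ℕ → ℕ → Cell → Set
SweepEffect T γ m c = ∀ K → proj₁ c < m + K →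
  sweep (height T) m K γ ≡ proj₁ c × (∀ y → sweep (height (c ∷ T)) m K y ≡ sweep (height T) m K (s γ y))

slide-stop-effect : ∀ T i k m γ → EndBelow (height T) m i γ → m ≤ i → i + height T i ≡ γ →
  SweepEffect T γ m (i , k)
slide-stop-effect T i k m γ ends m≤i top≡γ K i<end with split-interval m i K m≤i i<end
... | a , b , refl , refl = sends , composes
  where
  h = height T
  h′ = height ((m + a , k) ∷ T)
  sends : sweep h m (a + suc b) γ ≡ i
  sends = begin
    sweep h m (a + suc b) γ                                 ≡⟨ sweep-through h m a b γ γ ends ≤-refl ⟩
    sweep h (suc i) b (towerPerm i (h i) γ)                 ≡⟨ cong (λ z → sweep h (suc i) b (towerPerm i (h i) z)) (sym top≡γ) ⟩
    sweep h (suc i) b (towerPerm i (h i) (i + h i))         ≡⟨ cong (sweep h (suc i) b) (towerPerm-top i (h i)) ⟩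
    sweep h (suc i) b i                                     ≡⟨ sweep-below h (suc i) b i (n<1+n i) ⟩
    i                                                       ∎
  same-before : ∀ k′ → m ≤ k′ → k′ < m + a → h′ k′ ≡ h k′
  same-before k′ _ k′<i = height-∷-≢ (i , k) T k′ (>⇒≢ k′<i)
  same-after : ∀ k′ → suc i ≤ k′ → k′ < suc i + b → h′ k′ ≡ h k′
  same-after k′ i<k′ _ = height-∷-≢ (i , k) T k′ (<⇒≢ i<k′)
  composes : ∀ y → sweep h′ m (a + suc b) y ≡ sweep h m (a + suc b) (s γ y)
  composes y = begin
    sweep h′ m (a + suc b) y                                        ≡⟨ sweep-at h′ m a b y ⟩
    sweep h′ (suc i) b (towerPerm i (h′ i) (sweep h′ m a y))        ≡⟨ sweep-cong h′ h (suc i) b _ same-after ⟩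
    sweep h (suc i) b (towerPerm i (h′ i) (sweep h′ m a y))         ≡⟨ cong (λ z → sweep h (suc i) b (towerPerm i (h′ i) z))
                                                                            (sweep-cong h′ h m a y same-before) ⟩
    sweep h (suc i) b (towerPerm i (h′ i) (sweep h m a y))          ≡⟨ cong (λ n → sweep h (suc i) b (towerPerm i n (sweep h m a y)))
                                                                            (height-∷-≡ (i , k) T i refl) ⟩
    sweep h (suc i) b (towerPerm i (suc (h i)) (sweep h m a y))     ≡⟨ cong (sweep h (suc i) b) (towerPerm-grow i (h i) _) ⟩
    sweep h (suc i) b (towerPerm i (h i) (s (i + h i) (sweep h m a y))) ≡⟨ cong (λ g → sweep h (suc i) b (towerPerm i (h i) (s g (sweep h m a y))))
                                                                                top≡γ ⟩
    sweep h (suc i) b (towerPerm i (h i) (s γ (sweep h m a y)))     ≡⟨ cong (λ z → sweep h (suc i) b (towerPerm i (h i) z))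
                                                                            (sym (sweep-comm-s h m a γ y ends)) ⟩
    sweep h (suc i) b (towerPerm i (h i) (sweep h m a (s γ y)))     ≡⟨ sym (sweep-at h m a b (s γ y)) ⟩
    sweep h m (a + suc b) (s γ y)                                   ∎

slide-climb-effect : ∀ T (c : Cell) i m γ → EndBelow (height T) m i γ → m ≤ i → i ≤ γ →
  suc (suc γ) ≤ i + height T i → i < proj₁ c → SweepEffect T (suc γ) (suc i) c → SweepEffect T γ m c
slide-climb-effect T c i m γ ends m≤i i≤γ 2+γ≤top i<c climb K c<end
  with split-interval m i K m≤i (<-trans i<c c<end)
... | a , b , refl , refl = sends , composes
  where
  h = height T
  h′ = height (c ∷ T)
  IH = climb b (subst (proj₁ c <_) (trans (sym (+-assoc m a (suc b))) (+-suc i b)) c<end)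
  sends : sweep h m (a + suc b) γ ≡ proj₁ c
  sends = begin
    sweep h m (a + suc b) γ                                 ≡⟨ sweep-through h m a b γ γ ends ≤-refl ⟩
    sweep h (suc i) b (towerPerm i (h i) γ)                 ≡⟨ cong (sweep h (suc i) b)
                                                                    (towerPerm-inside i (h i) γ i≤γ (<-trans (n<1+n γ) 2+γ≤top)) ⟩
    sweep h (suc i) b (suc γ)                               ≡⟨ proj₁ IH ⟩
    proj₁ c                                                 ∎
  same-below : ∀ k′ → m ≤ k′ → k′ < suc i → h′ k′ ≡ h k′
  same-below k′ _ k′≤i = height-∷-≢ c T k′ (>⇒≢ (≤-<-trans (≤-pred k′≤i) i<c))
  composes : ∀ y → sweep h′ m (a + suc b) y ≡ sweep h m (a + suc b) (s γ y)
  composes y = begin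
    sweep h′ m (a + suc b) y                                            ≡⟨ sweep-at h′ m a b y ⟩
    sweep h′ (suc i) b (towerPerm i (h′ i) (sweep h′ m a y))            ≡⟨ cong₂ (λ n z → sweep h′ (suc i) b (towerPerm i n z))
                                                                                 (same-below i (m≤m+n m a) (n<1+n i))
                                                                                 (sweep-cong h′ h m a y (λ k′ p q → same-below k′ p (m<n⇒m<1+n q))) ⟩
    sweep h′ (suc i) b (towerPerm i (h i) (sweep h m a y))              ≡⟨ proj₂ IH _ ⟩
    sweep h (suc i) b (s (suc γ) (towerPerm i (h i) (sweep h m a y)))   ≡⟨ cong (sweep h (suc i) b)
                                                                                 (sym (towerPerm-shift-s i (h i) γ _ i≤γ 2+γ≤top)) ⟩
    sweep h (suc i) b (towerPerm i (h i) (s γ (sweep h m a y)))         ≡⟨ cong (λ z → sweep h (suc i) b (towerPerm i (h i) z))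
                                                                                 (sym (sweep-comm-s h m a γ y ends)) ⟩
    sweep h (suc i) b (towerPerm i (h i) (sweep h m a (s γ y)))         ≡⟨ sym (sweep-at h m a b (s γ y)) ⟩
    sweep h m (a + suc b) (s γ y)                                       ∎

SlideEffect : Diagram → ℕ → ℕ → Cell → Set
SlideEffect T γ m c = proj₂ c ≡ height T (proj₁ c) × m ≤ proj₁ c × SweepEffect T γ m c

slide-effect : ∀ {T γ m c} → IsTowerDiagram T → SlideP T γ m c → m ≤ γ → SlideEffect T γ m c
slide-effect {T} {γ} {m} V (s1a noDiag base∉T) m≤γ =
  sym empty , m≤γ , slide-stop-effect T γ 0 m γ ends m≤γ (trans (cong (γ +_) empty) (+-identityʳ γ))
  where
  empty : height T γ ≡ 0
  empty = n≤0⇒n≡0 (∉⇒height≤ V γ 0 base∉T)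
  ends = emptyDiagonal⇒endBelow V m γ γ (noDiag⇒empty noDiag) ≤-refl
slide-effect {T} {γ} {m} V (s1c noDiag _ γ1∈T rest) m≤γ with slide-effect V rest ≤-refl
... | on-top , γ<c , climb =
  on-top , ≤-trans m≤γ (<⇒≤ γ<c) , slide-climb-effect T _ γ m γ ends m≤γ ≤-refl 2+γ≤top γ<c climb
  where
  ends = emptyDiagonal⇒endBelow V m γ γ (noDiag⇒empty noDiag) ≤-refl
  2+γ≤top : suc (suc γ) ≤ γ + height T γ
  2+γ≤top = subst (_< γ + height T γ) (+-comm γ 1) (∈⇒<top V γ1∈T)
slide-effect {T} {γ} {m} V (s2a {i = i} {j} (m≤i , on-γ , ij∈T , empty) next∉T) _ =
  sym full , m≤i , slide-stop-effect T i (suc j) m γ ends m≤i (trans (cong (i +_) full) (trans (+-suc i j) on-γ))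
  where
  full : height T i ≡ suc j
  full = ≤-antisym (∉⇒height≤ V i (suc j) next∉T) (proj₁ (V i j) ij∈T)
  ends = emptyDiagonal⇒endBelow V m i γ empty (onDiagonal⇒≤ on-γ)
slide-effect {T} {γ} {m} V (s2c {i = i} {j} (m≤i , on-γ , _ , empty) _ i2+j∈T rest) _
  with slide-effect V rest (s≤s (onDiagonal⇒≤ on-γ))
... | on-top , i<c , climb =
  on-top , ≤-trans m≤i (<⇒≤ i<c) , slide-climb-effect T _ i m γ ends m≤i (onDiagonal⇒≤ on-γ) 2+γ≤top i<c climb
  where
  ends = emptyDiagonal⇒endBelow V m i γ empty (onDiagonal⇒≤ on-γ)
  2+γ≤top : suc (suc γ) ≤ i + height T i
  2+γ≤top = subst (_< i + height T i) (trans (+-suc i (suc j)) (cong suc (trans (+-suc i j) on-γ))) (∈⇒<top V i2+j∈T)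

slide-natPerm : ∀ {T α c} → IsTowerDiagram T → 1 ≤ α → SlideP T α 1 c →
  IsTowerDiagram (c ∷ T) × proj₁ c ≡ natPerm T α × (∀ x → natPerm (c ∷ T) x ≡ natPerm T (s α x))
slide-natPerm {T} {α} {c} V 1≤α slide with slide-effect V slide 1≤α
... | on-top , _ , effect =
  isTowerDiagram-∷ T c V on-top ,
  sym (trans (natPerm-sweep T K α max≤K) (proj₁ (effect K c≤K))) ,
  λ x → begin
    natPerm (c ∷ T) x              ≡⟨ natPerm-sweep (c ∷ T) K x ≤-refl ⟩
    sweep (height (c ∷ T)) 1 K x   ≡⟨ proj₂ (effect K c≤K) x ⟩
    sweep (height T) 1 K (s α x)   ≡⟨ sym (natPerm-sweep T K (s α x) max≤K) ⟩
    natPerm T (s α x)              ∎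
  where
  K = maxTower (c ∷ T)
  c≤K : proj₁ c < 1 + K
  c≤K = s≤s (m≤m⊔n (proj₁ c) (maxTower T))
  max≤K : maxTower T ≤ K
  max≤K = m≤n⊔m (proj₁ c) (maxTower T)

-- The p-th entry is g((s_{v₁} ⋯ s_{v_{p−1}})(v_p)).
createdTowers : (ℕ → ℕ) → List ℕ → List ℕ
createdTowers g [] = []
createdTowers g (α ∷ v) = g α ∷ createdTowers (λ x → g (s α x)) v

createdTowers-cong : ∀ g g′ v → (∀ x → g x ≡ g′ x) → createdTowers g v ≡ createdTowers g′ v
createdTowers-cong g g′ [] g≗g′ = refl
createdTowers-cong g g′ (α ∷ v) g≗g′ = cong₂ _∷_ (g≗g′ α) (createdTowers-cong _ _ v (λ x → g≗g′ (s α x)))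

slideSeq-natPerm : ∀ {T v T′ cs} → IsTowerDiagram T → SlideSeq T v T′ cs →
  IsTowerDiagram T′ × (∀ x → natPerm T′ x ≡ natPerm T (evalWord v x)) × map proj₁ cs ≡ createdTowers (natPerm T) v
slideSeq-natPerm V done = V , (λ x → refl) , refl
slideSeq-natPerm V (step {w = w} 1≤α slide rest) with slide-natPerm V 1≤α slide
... | V′ , tower , perm with slideSeq-natPerm V′ rest
... | V″ , perm′ , towers =
  V″ , (λ x → trans (perm′ x) (perm (evalWord w x))) , cong₂ _∷_ tower (trans towers (createdTowers-cong _ _ w perm))

-- Slides exist at ascents

<top⇒∈ : ∀ {T} → IsTowerDiagram T → ∀ {i k} → i + k < i + height T i → (i , k) ∈ T
<top⇒∈ V {i} {k} k<top = proj₂ (V i k) (+-cancelˡ-< i k _ k<top)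

top≤⇒∉ : ∀ {T} → IsTowerDiagram T → ∀ {i k} → i + height T i ≤ i + k → (i , k) ∉ T
top≤⇒∉ V top≤ mem = <⇒≱ (∈⇒<top V mem) top≤

data TopView (γ t : ℕ) : Set where
  at-γ      : t ≡ γ → TopView γ t
  at-1+γ    : t ≡ suc γ → TopView γ t
  above-1+γ : suc (suc γ) ≤ t → TopView γ t

top-view : ∀ γ t → γ ≤ t → TopView γ t
top-view γ t γ≤t with m≤n⇒m<n∨m≡n γ≤t
... | inj₂ γ≡t = at-γ (sym γ≡t)
... | inj₁ γ<t with m≤n⇒m<n∨m≡n γ<t
...   | inj₂ 1+γ≡t = at-1+γ (sym 1+γ≡t)
...   | inj₁ 1+γ<t = above-1+γ 1+γ<t

DiagonalSearch : Diagram → ℕ → ℕ → Set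
DiagonalSearch T m γ = NoDiag T m γ ⊎ (Σ ℕ λ i → Σ ℕ λ j → FirstOnDiag T m γ i j)

-- If tower m does not reach the diagonal, a search of the diagonal may start at m + 1.
∉-extend : ∀ {T} → IsTowerDiagram T → ∀ {m k γ} → ¬ k < height T m → m + suc k ≡ γ →
  ∀ i j → m ≤ i → suc (i + j) ≡ γ → (m < i → (i , j) ∉ T) → (i , j) ∉ T
∉-extend V {m} {k} k≮height m+1+k≡γ i j m≤i on-γ beyond with m≤n⇒m<n∨m≡n m≤i
... | inj₁ m<i = beyond m<i
... | inj₂ refl = λ mem → k≮height (subst (_< _) j≡k (proj₁ (V m j) mem))
  where
  j≡k : j ≡ k
  j≡k = +-cancelˡ-≡ m j k (suc-injective (trans on-γ (trans (sym m+1+k≡γ) (+-suc m k))))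

searchDiagonal : ∀ {T} → IsTowerDiagram T → ∀ m γ k → m + k ≡ γ → DiagonalSearch T m γ
searchDiagonal V m γ zero m+0≡γ = inj₁ λ i j m≤i on-γ _ →
  <⇒≱ (subst (i <_) (trans on-γ (trans (sym m+0≡γ) (+-identityʳ m))) (s≤s (m≤m+n i j))) m≤i
searchDiagonal {T} V m γ (suc k) m+1+k≡γ with k <? height T m
... | yes k<height = inj₂ (m , k , ≤-refl , trans (sym (+-suc m k)) m+1+k≡γ , proj₂ (V m k) k<height ,
                          λ i′ _ m≤i′ i′<m _ → ⊥-elim (<⇒≱ i′<m m≤i′))
... | no k≮height with searchDiagonal V (suc m) γ k (trans (sym (+-suc m k)) m+1+k≡γ)
...   | inj₁ noDiag = inj₁ λ i j m≤i on-γ → ∉-extend V k≮height m+1+k≡γ i j m≤i on-γ (λ m<i → noDiag i j m<i on-γ)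
...   | inj₂ (i , j , m<i , on-γ , mem , first) =
  inj₂ (i , j , <⇒≤ m<i , on-γ , mem ,
        λ i′ j′ m≤i′ i′<i on-γ′ → ∉-extend V k≮height m+1+k≡γ i′ j′ m≤i′ on-γ′ (λ m<i′ → first i′ j′ m<i′ i′<i on-γ′))

EmptyFrom : Diagram → ℕ → ℕ → Set
EmptyFrom T m K = ∀ i → m + K ≤ i → height T i ≡ 0

reaches⇒inRange : ∀ T m K {i γ} → EmptyFrom T m K → i ≤ γ → γ < i + height T i → i < m + K
reaches⇒inRange T m K {i} empty i≤γ γ<top = ≰⇒> λ m+K≤i →
  <⇒≱ γ<top (subst (λ n → i + n ≤ _) (sym (empty i m+K≤i)) (subst (_≤ _) (sym (+-identityʳ i)) i≤γ))

sweep-descent : ∀ T m i γ K → EndBelow (height T) m i γ → m ≤ i → i ≤ γ → i + height T i ≡ suc γ →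
  EmptyFrom T m K → sweep (height T) m K (suc γ) < sweep (height T) m K γ
sweep-descent T m i γ K ends m≤i i≤γ top≡1+γ empty
  with split-interval m i K m≤i (reaches⇒inRange T m K empty i≤γ (subst (γ <_) (sym top≡1+γ) (n<1+n γ)))
... | a , b , refl , refl = subst₂ _<_ (sym goes-to-i) (sym goes-up) (sweep-preserves-> h (suc i) b (suc γ) i (n<1+n i) (s≤s i≤γ))
  where
  h = height T
  goes-up : sweep h m (a + suc b) γ ≡ sweep h (suc i) b (suc γ)
  goes-up = trans (sweep-through h m a b γ γ ends ≤-refl)
                  (cong (sweep h (suc i) b) (towerPerm-inside i (h i) γ i≤γ (subst (γ <_) (sym top≡1+γ) (n<1+n γ))))
  goes-to-i : sweep h m (a + suc b) (suc γ) ≡ i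
  goes-to-i = begin
    sweep h m (a + suc b) (suc γ)              ≡⟨ sweep-through h m a b γ (suc γ) ends (n≤1+n γ) ⟩
    sweep h (suc i) b (towerPerm i (h i) (suc γ)) ≡⟨ cong (λ z → sweep h (suc i) b (towerPerm i (h i) z)) (sym top≡1+γ) ⟩
    sweep h (suc i) b (towerPerm i (h i) (i + h i)) ≡⟨ cong (sweep h (suc i) b) (towerPerm-top i (h i)) ⟩
    sweep h (suc i) b i                        ≡⟨ sweep-below h (suc i) b i (n<1+n i) ⟩
    i                                          ∎

sweep-ascent-climb : ∀ T m i γ K → EndBelow (height T) m i γ → m ≤ i → i ≤ γ → suc (suc γ) ≤ i + height T i →
  EmptyFrom T m K → sweep (height T) m K γ < sweep (height T) m K (suc γ) →
  Σ ℕ λ b → EmptyFrom T (suc i) b × sweep (height T) (suc i) b (suc γ) < sweep (height T) (suc i) b (suc (suc γ))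
sweep-ascent-climb T m i γ K ends m≤i i≤γ 2+γ≤top empty ascent
  with split-interval m i K m≤i (reaches⇒inRange T m K empty i≤γ (<-trans (n<1+n γ) 2+γ≤top))
... | a , b , refl , refl = b , empty′ , subst₂ _<_ (moves γ i≤γ ≤-refl (<-trans (n<1+n γ) 2+γ≤top))
                                                     (moves (suc γ) (m≤n⇒m≤1+n i≤γ) (n≤1+n γ) 2+γ≤top) ascent
  where
  h = height T
  empty′ : EmptyFrom T (suc i) b
  empty′ k end≤k = empty k (subst (_≤ k) (trans (sym (+-suc i b)) (+-assoc m a (suc b))) end≤k)
  moves : ∀ z → i ≤ z → γ ≤ z → z < i + h i → sweep h m (a + suc b) z ≡ sweep h (suc i) b (suc z)
  moves z i≤z γ≤z z<top = trans (sweep-through h m a b γ z ends γ≤z) (cong (sweep h (suc i) b) (towerPerm-inside i (h i) z i≤z z<top))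

-- Termination measure: P(γ, m) continues with P(γ + 1, _) at most f more times.
Fuel : Diagram → ℕ → ℕ → Set
Fuel T γ f = ∀ i → 0 < height T i → i + height T i ≤ γ + f

fuel-step : ∀ {T γ f} → Fuel T γ (suc f) → Fuel T (suc γ) f
fuel-step {T} {γ} {f} fuel i nonempty = subst (i + height T i ≤_) (+-suc γ f) (fuel i nonempty)

reaches⇒nonempty : ∀ {i γ} n → i ≤ γ → γ < i + n → 0 < n
reaches⇒nonempty {i} n i≤γ γ<top = +-cancelˡ-< i 0 n (subst (_< i + n) (sym (+-identityʳ i)) (≤-<-trans i≤γ γ<top))

slideP-exists : ∀ f T γ m → IsTowerDiagram T → m ≤ γ → Fuel T γ f → ∀ K → EmptyFrom T m K →
  sweep (height T) m K γ < sweep (height T) m K (suc γ) → Σ Cell (SlideP T γ m)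

-- The ascent of the sweep at γ survives the passage to P(γ+1, i+1), and the fuel runs out before the slide
-- could climb beyond every tower.
slideP-climbs : ∀ f T γ m i K → IsTowerDiagram T → EndBelow (height T) m i γ → m ≤ i → i ≤ γ →
  suc (suc γ) ≤ i + height T i → Fuel T γ f → EmptyFrom T m K →
  sweep (height T) m K γ < sweep (height T) m K (suc γ) → Σ Cell (SlideP T (suc γ) (suc i))
slideP-climbs zero T γ m i K V ends m≤i i≤γ 2+γ≤top fuel empty ascent =
  ⊥-elim (<⇒≱ (<-trans (n<1+n γ) 2+γ≤top)
              (≤-trans (fuel i (reaches⇒nonempty (height T i) i≤γ (<-trans (n<1+n γ) 2+γ≤top))) (≤-reflexive (+-identityʳ γ))))
slideP-climbs (suc f) T γ m i K V ends m≤i i≤γ 2+γ≤top fuel empty ascent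
  with sweep-ascent-climb T m i γ K ends m≤i i≤γ 2+γ≤top empty ascent
... | b , empty′ , ascent′ = slideP-exists f T (suc γ) (suc i) V (s≤s i≤γ) (fuel-step {T} fuel) b empty′ ascent′

-- The tower examined by P(γ, m) (tower γ under (S1)) ends at γ, and then a cell is created, or at γ + 1,
-- which would make γ a descent of the sweep, or higher, and then the procedure continues.
slideP-exists f T γ m V m≤γ fuel K empty ascent with searchDiagonal V m γ (γ ∸ m) (m+[n∸m]≡n m≤γ)
... | inj₁ noDiag with top-view γ (γ + height T γ) (m≤m+n γ _)
...   | at-γ top≡γ = _ , s1a noDiag (top≤⇒∉ {T} V (≤-reflexive (trans top≡γ (sym (+-identityʳ γ)))))
...   | at-1+γ top≡1+γ = ⊥-elim (<-asym ascent (sweep-descent T m γ γ K ends m≤γ ≤-refl top≡1+γ empty))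
  where ends = emptyDiagonal⇒endBelow V m γ γ (noDiag⇒empty noDiag) ≤-refl
...   | above-1+γ 2+γ≤top =
  let c , slide = slideP-climbs f T γ m γ K V ends m≤γ ≤-refl 2+γ≤top fuel empty ascent in
  c , s1c noDiag (<top⇒∈ V (<-trans (s≤s (≤-reflexive (+-identityʳ γ))) 2+γ≤top))
                 (<top⇒∈ V (subst (_≤ γ + height T γ) (cong suc (+-comm 1 γ)) 2+γ≤top)) slide
  where ends = emptyDiagonal⇒endBelow V m γ γ (noDiag⇒empty noDiag) ≤-refl
slideP-exists f T γ m V m≤γ fuel K empty ascent
    | inj₂ (i , j , first@(m≤i , on-γ , ij∈T , empty-before)) with top-view γ (i + height T i) γ≤top
  where
  γ≤top : γ ≤ i + height T i
  γ≤top = subst (_≤ _) on-γ (∈⇒<top V ij∈T)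
...   | at-γ top≡γ = _ , s2a first (top≤⇒∉ {T} V (≤-reflexive (trans top≡γ (sym i+1+j≡γ))))
  where
  i+1+j≡γ : i + suc j ≡ γ
  i+1+j≡γ = trans (+-suc i j) on-γ
...   | at-1+γ top≡1+γ = ⊥-elim (<-asym ascent (sweep-descent T m i γ K ends m≤i (onDiagonal⇒≤ on-γ) top≡1+γ empty))
  where ends = emptyDiagonal⇒endBelow V m i γ empty-before (onDiagonal⇒≤ on-γ)
...   | above-1+γ 2+γ≤top =
  let c , slide = slideP-climbs f T γ m i K V ends m≤i (onDiagonal⇒≤ on-γ) 2+γ≤top fuel empty ascent in
  c , s2c first (<top⇒∈ V (<-trans (s≤s (≤-reflexive i+1+j≡γ)) 2+γ≤top))
                (<top⇒∈ V (subst (_≤ i + height T i) (cong suc (sym i+2+j≡1+γ)) 2+γ≤top)) slide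
  where
  ends = emptyDiagonal⇒endBelow V m i γ empty-before (onDiagonal⇒≤ on-γ)
  i+1+j≡γ : i + suc j ≡ γ
  i+1+j≡γ = trans (+-suc i j) on-γ
  i+2+j≡1+γ : i + suc (suc j) ≡ suc γ
  i+2+j≡1+γ = trans (+-suc i (suc j)) (cong suc i+1+j≡γ)

slide-exists : ∀ {T α} → IsTowerDiagram T → 1 ≤ α → natPerm T α < natPerm T (suc α) → Σ Cell (SlideP T α 1)
slide-exists {T} {α} V 1≤α ascent =
  slideP-exists (maxTower T + length T) T α 1 V 1≤α fuel (maxTower T) (λ i → height-beyond-max T i)
    (subst₂ _<_ (natPerm-sweep T _ α ≤-refl) (natPerm-sweep T _ (suc α) ≤-refl) ascent)
  where
  fuel : Fuel T α (maxTower T + length T)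
  fuel i nonempty = ≤-trans (+-mono-≤ (≮⇒≥ λ max<i → <⇒≢ nonempty (sym (height-beyond-max T i max<i))) (height≤length T i))
                            (m≤n+m _ α)

Ascents : (ℕ → ℕ) → List ℕ → Set
Ascents g [] = ⊤
Ascents g (α ∷ v) = 1 ≤ α × g α < g (suc α) × Ascents (λ x → g (s α x)) v

Ascents-cong : ∀ g g′ v → (∀ x → g x ≡ g′ x) → Ascents g v → Ascents g′ v
Ascents-cong g g′ [] g≗g′ _ = tt
Ascents-cong g g′ (α ∷ v) g≗g′ (1≤α , ascent , rest) =
  1≤α , subst₂ _<_ (g≗g′ α) (g≗g′ (suc α)) ascent , Ascents-cong _ _ v (λ x → g≗g′ (s α x)) rest

Ascents-++ : ∀ g u v → Ascents g u → Ascents (λ x → g (evalWord u x)) v → Ascents g (u ++ v)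
Ascents-++ g [] v _ ascents-v = ascents-v
Ascents-++ g (α ∷ u) v (1≤α , ascent , rest) ascents-v = 1≤α , ascent , Ascents-++ (λ x → g (s α x)) u v rest ascents-v

slideSeq-exists : ∀ v {T} → IsTowerDiagram T → Ascents (natPerm T) v → Σ Diagram λ T′ → Σ (List Cell) λ cs → SlideSeq T v T′ cs
slideSeq-exists [] {T} V _ = T , [] , done
slideSeq-exists (α ∷ v) V (1≤α , ascent , rest) with slide-exists V 1≤α ascent
... | c , slide with slide-natPerm V 1≤α slide
... | V′ , _ , perm with slideSeq-exists v V′ (Ascents-cong _ _ v (λ x → sym (perm x)) rest)
... | T′ , cs , slides = T′ , c ∷ cs , step 1≤α slide slides

-- The natural word and its reversal consist of ascents

towerWord-ascents : ∀ g t H → 1 ≤ t → (∀ x → t < x → x ≤ t + H → g t < g x) → Ascents g (towerWord t H)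
towerWord-ascents g t zero _ _ = tt
towerWord-ascents g t (suc H) 1≤t g-min = subst (Ascents g) (sym (towerWord-suc t H))
  (1≤t , g-min (suc t) (n<1+n t) (subst (suc t ≤_) (sym (+-suc t H)) (s≤s (m≤m+n t H))) ,
   towerWord-ascents (λ x → g (s t x)) (suc t) H (m≤n⇒m≤1+n 1≤t) g-min′)
  where
  g-min′ : ∀ x → suc t < x → x ≤ suc t + H → g (s t (suc t)) < g (s t x)
  g-min′ x 1+t<x x≤top rewrite s-at-suc t | s-fix t x (>⇒≢ (<-trans (n<1+n t) 1+t<x)) (>⇒≢ 1+t<x) =
    g-min x (<-trans (n<1+n t) 1+t<x) (subst (x ≤_) (sym (+-suc t H)) x≤top)

towersWord-ascents : ∀ h N g → (∀ t x → 1 ≤ t → t ≤ N → t < x → g t < g x) → Ascents g (towersWord h N)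
towersWord-ascents h zero g _ = tt
towersWord-ascents h (suc N) g g-min = Ascents-++ g (towerWord (suc N) H) (towersWord h N)
  (towerWord-ascents g (suc N) H (s≤s z≤n) (λ x 1+N<x _ → g-min (suc N) x (s≤s z≤n) ≤-refl 1+N<x))
  (towersWord-ascents h N _ g-min′)
  where
  H = h (suc N)
  g-min′ : ∀ t x → 1 ≤ t → t ≤ N → t < x → g (towerPerm (suc N) H t) < g (towerPerm (suc N) H x)
  g-min′ t x 1≤t t≤N t<x rewrite towerPerm-below (suc N) H t (s≤s t≤N) =
    g-min t _ 1≤t (m≤n⇒m≤1+n t≤N) (towerPerm-preserves-> (suc N) H x t (s≤s t≤N) t<x)

towersPerm⁻¹-mono : ∀ h N x y → N < x → x < y → towersPerm⁻¹ h N x < towersPerm⁻¹ h N y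
towersPerm⁻¹-mono h zero x y _ x<y = x<y
towersPerm⁻¹-mono h (suc N) x y N<x x<y rewrite towersPerm⁻¹-suc h N x | towersPerm⁻¹-suc h N y =
  towersPerm⁻¹-mono h N _ _ (towerPerm⁻¹-≥ (suc N) (h (suc N)) x N<x) (towerPerm⁻¹-mono (suc N) (h (suc N)) x y N<x x<y)

reverse-towerWord-ascents : ∀ g t H → 1 ≤ t → (∀ x y → t ≤ x → x < y → g x < g y) → Ascents g (reverse (towerWord t H))
reverse-towerWord-ascents g t zero _ _ = tt
reverse-towerWord-ascents g t (suc H) 1≤t g-mono = subst (Ascents g) (sym reverse-towerWord)
  (Ascents-++ g (reverse (towerWord (suc t) H)) [ t ]
    (reverse-towerWord-ascents g (suc t) H (m≤n⇒m≤1+n 1≤t) (λ x y 1+t≤x → g-mono x y (≤-trans (n≤1+n t) 1+t≤x)))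
    (1≤t , subst₂ (λ u v → g u < g v) (sym (towerPerm⁻¹-below (suc t) H t (n<1+n t))) (sym (towerPerm⁻¹-bottom (suc t) H))
                  (g-mono t (suc t + H) ≤-refl (s≤s (m≤m+n t H))) , tt))
  where
  reverse-towerWord : reverse (towerWord t (suc H)) ≡ reverse (towerWord (suc t) H) ++ [ t ]
  reverse-towerWord = trans (cong reverse (towerWord-suc t H)) (unfold-reverse t (towerWord (suc t) H))

reverse-towersWord-ascents : ∀ h N → Ascents (λ x → x) (reverse (towersWord h N))
reverse-towersWord-ascents h zero = tt
reverse-towersWord-ascents h (suc N) =
  subst (Ascents (λ x → x)) (sym (reverse-++ (towerWord (suc N) (h (suc N))) (towersWord h N)))
    (Ascents-++ (λ x → x) (reverse (towersWord h N)) (reverse (towerWord (suc N) (h (suc N))))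
      (reverse-towersWord-ascents h N)
      (reverse-towerWord-ascents (towersPerm⁻¹ h N) (suc N) (h (suc N)) (s≤s z≤n) (towersPerm⁻¹-mono h N)))

createdTowers-++ : ∀ g u v → createdTowers g (u ++ v) ≡ createdTowers g u ++ createdTowers (λ x → g (evalWord u x)) v
createdTowers-++ g [] v = refl
createdTowers-++ g (α ∷ u) v = cong (g α ∷_) (createdTowers-++ (λ x → g (s α x)) u v)

createdTowersʳ : (ℕ → ℕ) → List ℕ → List ℕ
createdTowersʳ g [] = []
createdTowersʳ g (α ∷ v) = g (evalWord (reverse v) α) ∷ createdTowersʳ g v

createdTowers-reverse : ∀ g v → createdTowers g (reverse v) ≡ reverse (createdTowersʳ g v)
createdTowers-reverse g [] = refl
createdTowers-reverse g (α ∷ v) = begin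
  createdTowers g (reverse (α ∷ v))                                  ≡⟨ cong (createdTowers g) (unfold-reverse α v) ⟩
  createdTowers g (reverse v ++ [ α ])                               ≡⟨ createdTowers-++ g (reverse v) [ α ] ⟩
  createdTowers g (reverse v) ++ [ g (evalWord (reverse v) α) ]      ≡⟨ cong (_++ [ g (evalWord (reverse v) α) ]) (createdTowers-reverse g v) ⟩
  reverse (createdTowersʳ g v) ++ [ g (evalWord (reverse v) α) ]     ≡⟨ sym (unfold-reverse _ (createdTowersʳ g v)) ⟩
  reverse (createdTowersʳ g (α ∷ v))                                 ∎

createdTowersʳ-++ : ∀ g u v →
  createdTowersʳ g (u ++ v) ≡ createdTowersʳ (λ x → g (evalWord (reverse v) x)) u ++ createdTowersʳ g v
createdTowersʳ-++ g [] v = refl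
createdTowersʳ-++ g (α ∷ u) v = cong₂ _∷_
  (cong g (trans (cong (λ w → evalWord w α) (reverse-++ u v)) (evalWord-++ (reverse v) (reverse u) α)))
  (createdTowersʳ-++ g u v)

createdTowers-towerWord : ∀ g t H → createdTowers g (towerWord t H) ≡ replicate H (g t)
createdTowers-towerWord g t zero = refl
createdTowers-towerWord g t (suc H) = trans (cong (createdTowers g) (towerWord-suc t H))
  (cong (g t ∷_) (trans (createdTowers-towerWord (λ x → g (s t x)) (suc t) H) (cong (λ z → replicate H (g z)) (s-at-suc t))))

imagesFrom : (ℕ → ℕ) → ℕ → ℕ → List ℕ
imagesFrom g t zero = []
imagesFrom g t (suc H) = g t ∷ imagesFrom g (suc t) H

createdTowersʳ-towerWord : ∀ g t H → createdTowersʳ g (towerWord t H) ≡ imagesFrom g t H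
createdTowersʳ-towerWord g t zero = refl
createdTowersʳ-towerWord g t (suc H) = trans (cong (createdTowersʳ g) (towerWord-suc t H))
  (cong₂ _∷_ (cong g (towerPerm⁻¹-below (suc t) H t (n<1+n t))) (createdTowersʳ-towerWord g (suc t) H))

-- Column and row of the cells of a tower diagram, in the order of the natural labelling.
columns : (ℕ → ℕ) → ℕ → List ℕ
columns h zero = []
columns h (suc N) = replicate (h (suc N)) (suc N) ++ columns h N

rows : (ℕ → ℕ) → ℕ → List ℕ
rows h zero = []
rows h (suc N) = imagesFrom (towersPerm⁻¹ h N) (suc N) (h (suc N)) ++ rows h N

createdTowers-towersWord : ∀ h N g → (∀ x → x ≤ N → g x ≡ x) → createdTowers g (towersWord h N) ≡ columns h N
createdTowers-towersWord h zero g _ = refl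
createdTowers-towersWord h (suc N) g g-id = begin
  createdTowers g (towersWord h (suc N))                                     ≡⟨ createdTowers-++ g (towerWord (suc N) H) (towersWord h N) ⟩
  createdTowers g (towerWord (suc N) H) ++ createdTowers g′ (towersWord h N) ≡⟨ cong₂ _++_ (createdTowers-towerWord g (suc N) H)
                                                                                          (createdTowers-towersWord h N g′ g′-id) ⟩
  replicate H (g (suc N)) ++ columns h N                                     ≡⟨ cong (λ t → replicate H t ++ columns h N) (g-id (suc N) ≤-refl) ⟩
  columns h (suc N)                                                          ∎
  where
  H = h (suc N)
  g′ = λ x → g (towerPerm (suc N) H x)
  g′-id : ∀ x → x ≤ N → g′ x ≡ x
  g′-id x x≤N = trans (cong g (towerPerm-below (suc N) H x (s≤s x≤N))) (g-id x (m≤n⇒m≤1+n x≤N))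

createdTowersʳ-towersWord : ∀ h N → createdTowersʳ (λ x → x) (towersWord h N) ≡ rows h N
createdTowersʳ-towersWord h zero = refl
createdTowersʳ-towersWord h (suc N) =
  trans (createdTowersʳ-++ (λ x → x) (towerWord (suc N) (h (suc N))) (towersWord h N))
        (cong₂ _++_ (createdTowersʳ-towerWord (towersPerm⁻¹ h N) (suc N) (h (suc N))) (createdTowersʳ-towersWord h N))

zip-++ : ∀ {A B : Set} (a b : List A) (c d : List B) → length a ≡ length c → zip (a ++ b) (c ++ d) ≡ zip a c ++ zip b d
zip-++ [] b [] d _ = refl
zip-++ (x ∷ a) b (y ∷ c) d |a|≡|c| = cong ((x , y) ∷_) (zip-++ a b c d (suc-injective |a|≡|c|))

length-imagesFrom : ∀ g t H → length (imagesFrom g t H) ≡ H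
length-imagesFrom g t zero = refl
length-imagesFrom g t (suc H) = cong suc (length-imagesFrom g (suc t) H)

∈-zip-imagesFrom⁻ : ∀ g a H (t : ℕ) i j → (i , j) ∈ zip (imagesFrom g a H) (replicate H t) →
  j ≡ t × Σ ℕ λ k → k < H × i ≡ g (a + k)
∈-zip-imagesFrom⁻ g a (suc H) t i j (here refl) = refl , 0 , s≤s z≤n , cong g (sym (+-identityʳ a))
∈-zip-imagesFrom⁻ g a (suc H) t i j (there mem) with ∈-zip-imagesFrom⁻ g (suc a) H t i j mem
... | j≡t , k , k<H , i≡g = j≡t , suc k , s≤s k<H , trans i≡g (cong g (sym (+-suc a k)))

∈-zip-imagesFrom⁺ : ∀ g a H (t : ℕ) k → k < H → (g (a + k) , t) ∈ zip (imagesFrom g a H) (replicate H t)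
∈-zip-imagesFrom⁺ g a (suc H) t zero _ = here (cong (_, t) (cong g (+-identityʳ a)))
∈-zip-imagesFrom⁺ g a (suc H) t (suc k) (s≤s k<H) =
  there (subst (λ z → (g z , t) ∈ zip (imagesFrom g (suc a) H) (replicate H t)) (sym (+-suc a k)) (∈-zip-imagesFrom⁺ g (suc a) H t k k<H))

TopRow : (ℕ → ℕ) → ℕ → ℕ → Set
TopRow h N i = Σ ℕ λ k → k < h (suc N) × i ≡ towersPerm⁻¹ h N (suc N + k)

RotheCell : (ℕ → ℕ) → ℕ → ℕ → ℕ → Set
RotheCell h zero i j = ⊥
RotheCell h (suc N) i j = (j ≡ suc N × TopRow h N i) ⊎ RotheCell h N i j

RotheCell-bound : ∀ h N i j → RotheCell h N i j → j ≤ N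
RotheCell-bound h (suc N) i j (inj₁ (refl , _)) = ≤-refl
RotheCell-bound h (suc N) i j (inj₂ cell) = m≤n⇒m≤1+n (RotheCell-bound h N i j cell)

zip-rows-columns : ∀ h N → zip (rows h (suc N)) (columns h (suc N)) ≡
  zip (imagesFrom (towersPerm⁻¹ h N) (suc N) (h (suc N))) (replicate (h (suc N)) (suc N)) ++ zip (rows h N) (columns h N)
zip-rows-columns h N = zip-++ (imagesFrom _ (suc N) (h (suc N))) (rows h N) (replicate (h (suc N)) (suc N)) (columns h N)
  (trans (length-imagesFrom _ _ _) (sym (length-replicate (h (suc N)))))

∈-zip⇒RotheCell : ∀ h N i j → (i , j) ∈ zip (rows h N) (columns h N) → RotheCell h N i j
∈-zip⇒RotheCell h (suc N) i j mem rewrite zip-rows-columns h N with ∈-++⁻ (zip (imagesFrom _ (suc N) (h (suc N))) _) mem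
... | inj₁ top-mem = inj₁ (∈-zip-imagesFrom⁻ _ (suc N) (h (suc N)) (suc N) i j top-mem)
... | inj₂ rest-mem = inj₂ (∈-zip⇒RotheCell h N i j rest-mem)

RotheCell⇒∈-zip : ∀ h N i j → RotheCell h N i j → (i , j) ∈ zip (rows h N) (columns h N)
RotheCell⇒∈-zip h (suc N) i j cell rewrite zip-rows-columns h N with cell
... | inj₁ (refl , k , k<H , refl) = ∈-++⁺ˡ (∈-zip-imagesFrom⁺ (towersPerm⁻¹ h N) (suc N) (h (suc N)) (suc N) k k<H)
... | inj₂ rest = ∈-++⁺ʳ (zip (imagesFrom _ (suc N) (h (suc N))) _) (RotheCell⇒∈-zip h N i j rest)

-- Inversions of the natural permutation

IsInversion : (ℕ → ℕ) → (ℕ → ℕ) → ℕ → ℕ → Set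
IsInversion f f⁻¹ i j = j < f i × i < f⁻¹ j

isInversion-cong : ∀ {f f′ g g′} → (∀ x → f x ≡ f′ x) → (∀ x → g x ≡ g′ x) →
  ∀ i j → IsInversion f g i j ⇔ IsInversion f′ g′ i j
isInversion-cong f≗f′ g≗g′ i j = mk⇔
  (λ (j<fi , i<gj) → subst (j <_) (f≗f′ i) j<fi , subst (i <_) (g≗g′ j) i<gj)
  (λ (j<fi , i<gj) → subst (j <_) (sym (f≗f′ i)) j<fi , subst (i <_) (sym (g≗g′ j)) i<gj)

Inversion : (ℕ → ℕ) → ℕ → ℕ → ℕ → Set
Inversion h N = IsInversion (towersPerm h N) (towersPerm⁻¹ h N)

towerPerm-<-invariant : ∀ t H j z → j < t → j < towerPerm t H z ⇔ j < z
towerPerm-<-invariant t H j z j<t with towerPerm-view t H z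
... | below _ e        rewrite e = ⇔.refl
... | inside t≤z _ e   rewrite e = mk⇔ (λ _ → <-≤-trans j<t t≤z) m<n⇒m<1+n
... | top z≡top e      rewrite e = mk⇔ (λ _ → <-≤-trans j<t (subst (t ≤_) (sym z≡top) (m≤m+n t H))) (λ _ → j<t)
... | above _ e        rewrite e = ⇔.refl

inversion-below : ∀ h N i j → j < suc N → Inversion h (suc N) i j ⇔ Inversion h N i j
inversion-below h N i j j<1+N = mk⇔
  (λ (j<πi , i<π⁻¹j) → Equivalence.to j<-same (subst (j <_) (towersPerm-suc h N i) j<πi) , subst (i <_) π⁻¹j-same i<π⁻¹j)
  (λ (j<πi , i<π⁻¹j) → subst (j <_) (sym (towersPerm-suc h N i)) (Equivalence.from j<-same j<πi) ,
                        subst (i <_) (sym π⁻¹j-same) i<π⁻¹j)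
  where
  H = h (suc N)
  j<-same : j < towerPerm (suc N) H (towersPerm h N i) ⇔ j < towersPerm h N i
  j<-same = towerPerm-<-invariant (suc N) H j _ j<1+N
  π⁻¹j-same : towersPerm⁻¹ h (suc N) j ≡ towersPerm⁻¹ h N j
  π⁻¹j-same = trans (towersPerm⁻¹-suc h N j) (cong (towersPerm⁻¹ h N) (towerPerm⁻¹-below (suc N) H j j<1+N))

-- The cycle of tower N+1 sends z above N+1 exactly when N+1 ≤ z < N+1+H.
inversion-top : ∀ h N i → Inversion h (suc N) i (suc N) ⇔ TopRow h N i
inversion-top h N i = mk⇔ to from
  where
  H = h (suc N)
  z = towersPerm h N i
  i≡π⁻¹z : i ≡ towersPerm⁻¹ h N z
  i≡π⁻¹z = sym (evalWord-reverse-inverseˡ (towersWord h N) i)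
  π⁻¹top : towersPerm⁻¹ h (suc N) (suc N) ≡ towersPerm⁻¹ h N (suc N + H)
  π⁻¹top = trans (towersPerm⁻¹-suc h N (suc N)) (cong (towersPerm⁻¹ h N) (towerPerm⁻¹-bottom (suc N) H))
  to : Inversion h (suc N) i (suc N) → TopRow h N i
  to (1+N<πi , i<π⁻¹top) with towerPerm-view (suc N) H z
  ... | below z<1+N e = ⊥-elim (<-asym z<1+N (subst (suc N <_) (trans (towersPerm-suc h N i) e) 1+N<πi))
  ... | top _ e = ⊥-elim (<-irrefl (sym (trans (towersPerm-suc h N i) e)) 1+N<πi)
  ... | above top<z _ = ⊥-elim (<-asym (subst₂ _<_ i≡π⁻¹z π⁻¹top i<π⁻¹top)
                                       (towersPerm⁻¹-mono h N (suc N + H) z (s≤s (m≤m+n N H)) top<z))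
  ... | inside 1+N≤z z<top _ = z ∸ suc N , +-cancelˡ-< (suc N) _ _ (subst (_< suc N + H) (sym (m+[n∸m]≡n 1+N≤z)) z<top) ,
                               trans i≡π⁻¹z (cong (towersPerm⁻¹ h N) (sym (m+[n∸m]≡n 1+N≤z)))
  from : TopRow h N i → Inversion h (suc N) i (suc N)
  from (k , k<H , refl) =
    1+N<πi , subst (towersPerm⁻¹ h N (suc N + k) <_) (sym π⁻¹top)
                   (towersPerm⁻¹-mono h N _ _ (s≤s (m≤m+n N k)) (+-monoʳ-< (suc N) k<H))
    where
    πi≡ : towersPerm h N (towersPerm⁻¹ h N (suc N + k)) ≡ suc N + k
    πi≡ = evalWord-reverse-inverseʳ (towersWord h N) (suc N + k)
    1+N<πi : suc N < towersPerm h (suc N) (towersPerm⁻¹ h N (suc N + k))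
    1+N<πi = subst (suc N <_)
      (sym (trans (towersPerm-suc h N _) (trans (cong (towerPerm (suc N) H) πi≡)
                  (towerPerm-inside (suc N) H (suc N + k) (m≤m+n (suc N) k) (+-monoʳ-< (suc N) k<H)))))
      (s≤s (m≤m+n (suc N) k))

-- Above N the inverse is increasing, so no inversion has its column there.
inversion-beyond : ∀ h N i j → N < j → ¬ Inversion h N i j
inversion-beyond h N i j N<j (j<πi , i<π⁻¹j) =
  <-asym i<π⁻¹j (subst (towersPerm⁻¹ h N j <_) (evalWord-reverse-inverseˡ (towersWord h N) i)
                       (towersPerm⁻¹-mono h N j _ N<j j<πi))

inversion⇔RotheCell : ∀ h N i j → Inversion h N i j ⇔ RotheCell h N i j
inversion⇔RotheCell h zero i j = mk⇔ (λ (j<i , i<j) → <-asym j<i i<j) λ ()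
inversion⇔RotheCell h (suc N) i j with <-cmp j (suc N)
... | tri< j<1+N _ _ = ⇔.trans (inversion-below h N i j j<1+N)
                      (⇔.trans (inversion⇔RotheCell h N i j) (mk⇔ inj₂ λ { (inj₁ (j≡1+N , _)) → ⊥-elim (<⇒≢ j<1+N j≡1+N)
                                                                     ; (inj₂ cell) → cell }))
... | tri≈ _ refl _ = ⇔.trans (inversion-top h N i) (mk⇔ (λ row → inj₁ (refl , row))
                      λ { (inj₁ (_ , row)) → row ; (inj₂ cell) → ⊥-elim (1+n≰n (RotheCell-bound h N i (suc N) cell)) })
... | tri> _ _ 1+N<j = mk⇔ (λ inv → ⊥-elim (inversion-beyond h (suc N) i j 1+N<j inv))
                          (λ cell → ⊥-elim (<⇒≱ 1+N<j (RotheCell-bound h (suc N) i j cell)))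

module _ (ω : FinPerm) where

  inv-fixed : ∀ x → (x ≡ 0 ⊎ n ω < x) → inv ω x ≡ x
  inv-fixed x outside = trans (cong (inv ω) (sym (fixed ω x outside))) (inv-fun ω x)

  fun-bounded : ∀ x → x ≤ n ω → fun ω x ≤ n ω
  fun-bounded x x≤n with fun ω x ≤? n ω
  ... | yes fx≤n = fx≤n
  ... | no fx≰n = ⊥-elim (fx≰n (subst (_≤ n ω) x≡fx x≤n))
    where
    x≡fx : x ≡ fun ω x
    x≡fx = trans (sym (inv-fun ω x)) (trans (inv-fixed (fun ω x) (inj₂ (≰⇒> fx≰n))) refl)

  inv-bounded : ∀ x → x ≤ n ω → inv ω x ≤ n ω
  inv-bounded x x≤n with inv ω x ≤? n ω
  ... | yes ix≤n = ix≤n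
  ... | no ix≰n = ⊥-elim (ix≰n (subst (_≤ n ω) (trans (sym (fun-inv ω x)) (fixed ω (inv ω x) (inj₂ (≰⇒> ix≰n)))) x≤n))

  inRothe⇔isInversion : ∀ i j → InRothe ω (i , j) ⇔ IsInversion (fun ω) (inv ω) i j
  inRothe⇔isInversion i j = mk⇔ (λ (_ , _ , _ , _ , j<fi , i<ij) → j<fi , i<ij) λ (j<fi , i<ij) →
    1≤i j<fi , i≤n j<fi i<ij , 1≤j i<ij , j≤n j<fi i<ij , j<fi , i<ij
    where
    1≤i : j < fun ω i → 1 ≤ i
    1≤i j<fi = n≢0⇒n>0 λ { refl → n≮0 (subst (j <_) (fixed ω 0 (inj₁ refl)) j<fi) }
    1≤j : i < inv ω j → 1 ≤ j
    1≤j i<ij = n≢0⇒n>0 λ { refl → n≮0 (subst (i <_) (inv-fixed 0 (inj₁ refl)) i<ij) }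
    j≤n : j < fun ω i → i < inv ω j → j ≤ n ω
    j≤n j<fi i<ij with j ≤? n ω | i ≤? n ω
    ... | yes j≤n′ | _ = j≤n′
    ... | no j≰n | yes i≤n′ = ⊥-elim (<⇒≱ j<fi (≤-trans (fun-bounded i i≤n′) (<⇒≤ (≰⇒> j≰n))))
    ... | no j≰n | no i≰n = ⊥-elim (<-asym (subst (i <_) (inv-fixed j (inj₂ (≰⇒> j≰n))) i<ij)
                                            (subst (j <_) (fixed ω i (inj₂ (≰⇒> i≰n))) j<fi))
    i≤n : j < fun ω i → i < inv ω j → i ≤ n ω
    i≤n j<fi i<ij = <⇒≤ (<-≤-trans i<ij (inv-bounded j (j≤n j<fi i<ij)))

createdTowers-from-[] : ∀ {v T cs} → SlideSeq [] v T cs → map proj₁ cs ≡ createdTowers (λ x → x) v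
createdTowers-from-[] slides = proj₂ (proj₂ (slideSeq-natPerm isTowerDiagram-[] slides))

natPerm-from-[] : ∀ {v T cs} → SlideSeq [] v T cs → ∀ x → natPerm T x ≡ evalWord v x
natPerm-from-[] slides = proj₁ (proj₂ (slideSeq-natPerm isTowerDiagram-[] slides))

creates-natWord : ∀ T → Σ (List Cell) (Creates (natWord T))
creates-natWord T with slideSeq-exists (natWord T) isTowerDiagram-[]
                         (towersWord-ascents (height T) (maxTower T) (λ x → x) λ _ _ _ _ t<x → t<x)
... | T′ , cs , slides = cs , T′ , slides

creates-reverse-natWord : ∀ T → Σ (List Cell) (Creates (reverse (natWord T)))
creates-reverse-natWord T with slideSeq-exists (reverse (natWord T)) isTowerDiagram-[]
                                 (reverse-towersWord-ascents (height T) (maxTower T))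
... | T′ , rs , slides = rs , T′ , slides

columns-natWord : ∀ {T cs} → Creates (natWord T) cs → map proj₁ cs ≡ columns (height T) (maxTower T)
columns-natWord {T} (_ , slides) =
  trans (createdTowers-from-[] slides) (createdTowers-towersWord (height T) (maxTower T) (λ x → x) λ _ _ → refl)

rows-reverse-natWord : ∀ {T rs} → Creates (reverse (natWord T)) rs → map proj₁ (reverse rs) ≡ rows (height T) (maxTower T)
rows-reverse-natWord {T} {rs} (_ , slides) = begin
  map proj₁ (reverse rs)                                       ≡⟨ reverse-map proj₁ rs ⟩
  reverse (map proj₁ rs)                                       ≡⟨ cong reverse (createdTowers-from-[] slides) ⟩
  reverse (createdTowers (λ x → x) (reverse (natWord T)))      ≡⟨ cong reverse (createdTowers-reverse (λ x → x) (natWord T)) ⟩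
  reverse (reverse (createdTowersʳ (λ x → x) (natWord T)))     ≡⟨ reverse-involutive _ ⟩
  createdTowersʳ (λ x → x) (natWord T)                         ≡⟨ createdTowersʳ-towersWord (height T) (maxTower T) ⟩
  rows (height T) (maxTower T)                                 ∎

inRothe⇔∈-zip : ∀ ω T → (∀ x → natPerm T x ≡ fun ω x) →
  ∀ i j → InRothe ω (i , j) ⇔ (i , j) ∈ zip (rows (height T) (maxTower T)) (columns (height T) (maxTower T))
inRothe⇔∈-zip ω T π≗fun i j =
  ⇔.trans (inRothe⇔isInversion ω i j)
  (⇔.trans (isInversion-cong (λ x → sym (π≗fun x)) (λ x → sym (π⁻¹≗inv x)) i j)
  (⇔.trans (inversion⇔RotheCell h N i j)
           (mk⇔ (RotheCell⇒∈-zip h N i j) (∈-zip⇒RotheCell h N i j))))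
  where
  h = height T
  N = maxTower T
  π⁻¹≗inv : ∀ x → towersPerm⁻¹ h N x ≡ inv ω x
  π⁻¹≗inv x = begin
    towersPerm⁻¹ h N x                                 ≡⟨ cong (towersPerm⁻¹ h N) (sym (fun-inv ω x)) ⟩
    towersPerm⁻¹ h N (fun ω (inv ω x))                 ≡⟨ cong (towersPerm⁻¹ h N) (sym (π≗fun (inv ω x))) ⟩
    towersPerm⁻¹ h N (towersPerm h N (inv ω x))        ≡⟨ evalWord-reverse-inverseˡ (natWord T) (inv ω x) ⟩
    inv ω x                                            ∎

theorem7p7 : (ω : FinPerm) (η : List ℕ) → IsNaturalWord ω η →
    (Σ (List Cell) λ cs → Σ (List Cell) λ rs → Creates η cs × Creates (reverse η) rs)
    × (∀ cs rs → Creates η cs → Creates (reverse η) rs →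
         ∀ i j → InRothe ω (i , j) ⇔ ((i , j) ∈ zip (map proj₁ (reverse rs)) (map proj₁ cs)))
theorem7p7 ω .(natWord T) (w , ((_ , w≗ω) , _) , T , _ , slides , refl) =
  (proj₁ (creates-natWord T) , proj₁ (creates-reverse-natWord T) , proj₂ (creates-natWord T) , proj₂ (creates-reverse-natWord T)) ,
  λ cs rs created reverse-created i j →
    subst (λ pairs → InRothe ω (i , j) ⇔ (i , j) ∈ pairs)
          (sym (cong₂ zip (rows-reverse-natWord {T} reverse-created) (columns-natWord {T} created)))
          (inRothe⇔∈-zip ω T π≗fun i j)
  where
  π≗fun : ∀ x → natPerm T x ≡ fun ω x
  π≗fun x = trans (natPerm-from-[] slides x) (w≗ω x)
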